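{- Let $H$ be a 3-uniform hypergraph that does not contain $C_4$ as a trace, let $A$ be the set of edges of $H$ containing at least one pair of co-degree $1$ in $H$, and let $B=H\setminus A$. Then for any two distinct vertices $x,y \in V(H)$, $|N_1(x)\cap N_1(y)|\leq 7$.
   Context: The co-degree $d_H(u,w)$ is the number of edges of $H$ containing $\{u,w\}$. For a vertex $x$, $N_1(x)$ denotes the set of vertices $z\neq x$ such that some edge of $B$ contains both $x$ and $z$. $H$ contains $C_4$ as a trace if there exist distinct vertices $a_1,a_2,a_3,a_4$ and four distinct edges $f_1,f_2,f_3,f_4$ of $H$ with $f_i\cap\{a_1,a_2,a_3,a_4\}=\{a_i,a_{i+1}\}$ (indices mod 4). -}

module Defs where

open import Data.Nat using (ℕ; _≤_)
open import Data.Fin using (Fin)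
open import Data.Fin.Subset using (Subset; _∈_; _∉_; ∣_∣)
open import Data.Fin.Subset.Properties using (_∈?_)
open import Data.List using (List; length; filter)
open import Data.List.Membership.Propositional using () renaming (_∈_ to _∈ₗ_)
open import Data.List.Relation.Unary.Unique.Propositional using (Unique)
open import Data.List.Relation.Unary.All using (All)
open import Data.Product using (Σ; ∃; ∃-syntax; _×_; _,_)
open import Relation.Binary.PropositionalEquality using (_≡_; _≢_)
open import Relation.Nullary using (¬_)
open import Relation.Nullary.Decidable using (_×-dec_)

Hypergraph : ℕ → Set
Hypergraph n = List (Subset n)

-- 3-uniform: edges are pairwise distinct (so H is a set of edges) and each has exactly 3 vertices.
record ThreeUniform {n : ℕ} (H : Hypergraph n) : Set where
  field
    edges-distinct : Unique H
    edges-size3    : All (λ e → ∣ e ∣ ≡ 3) H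

codeg : {n : ℕ} → Hypergraph n → Fin n → Fin n → ℕ
codeg H u w = length (filter (λ e → (u ∈? e) ×-dec (w ∈? e)) H)

InA : {n : ℕ} → Hypergraph n → Subset n → Set
InA H e = e ∈ₗ H × (∃[ u ] ∃[ w ] (u ≢ w × u ∈ e × w ∈ e × codeg H u w ≡ 1))

InB : {n : ℕ} → Hypergraph n → Subset n → Set
InB H e = e ∈ₗ H × ¬ InA H e

N1 : {n : ℕ} → Hypergraph n → Fin n → Fin n → Set
N1 H x z = z ≢ x × (∃[ e ] (InB H e × x ∈ e × z ∈ e))

TraceEdge : {n : ℕ} → Subset n → Fin n → Fin n → Fin n → Fin n → Set
TraceEdge f a b c d = a ∈ f × b ∈ f × c ∉ f × d ∉ f

ContainsC4Trace : {n : ℕ} → Hypergraph n → Set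
ContainsC4Trace H =
  ∃[ a₁ ] ∃[ a₂ ] ∃[ a₃ ] ∃[ a₄ ] ∃[ f₁ ] ∃[ f₂ ] ∃[ f₃ ] ∃[ f₄ ]
    ( a₁ ≢ a₂ × a₁ ≢ a₃ × a₁ ≢ a₄ × a₂ ≢ a₃ × a₂ ≢ a₄ × a₃ ≢ a₄
    × f₁ ≢ f₂ × f₁ ≢ f₃ × f₁ ≢ f₄ × f₂ ≢ f₃ × f₂ ≢ f₄ × f₃ ≢ f₄
    × f₁ ∈ₗ H × f₂ ∈ₗ H × f₃ ∈ₗ H × f₄ ∈ₗ H
    × TraceEdge f₁ a₁ a₂ a₃ a₄
    × TraceEdge f₂ a₂ a₃ a₄ a₁
    × TraceEdge f₃ a₃ a₄ a₁ a₂
    × TraceEdge f₄ a₄ a₁ a₂ a₃ )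

-- Say a is blocked from w on the x-side if every edge through x and w meets {y, a}. A common
-- neighbour w lies on an edge of B through x, hence on at least two edges through x and w, and
-- they cannot both be {x, w, y}; an edge through x and w missing y but meeting {y, a} and {y, b}
-- would contain the four vertices x, w, a, b. So at most one common neighbour a ≠ w is blocked
-- from w on the x-side, and likewise on the y-side. If neither of two common neighbours a, w is
-- blocked from the other on either side, the four witnessing edges form a C₄ trace on x, a, y, w.
-- Hence in the blocking digraph on the k common neighbours every pair is joined and every
-- out-degree is at most 2, so k(k-1)/2 ≤ 2k and k ≤ 5.
module Submission where

open import Defs
open import Data.Fin using (Fin; _≟_)
open import Data.Fin.Subset using (Subset; _∈_; _∉_; ∣_∣; _-_; _⊆_)
open import Data.Fin.Subset.Properties using (_∈?_; x∈p⇒∣p-x∣<∣p∣; x∈p∧x≢y⇒x∈p-y; ⊆-antisym)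
open import Data.Bool using (true; false)
open import Data.List using (List; []; _∷_; length; filter; map)
open import Data.List.Membership.Propositional using (find; lose) renaming (_∈_ to _∈ₗ_)
open import Data.List.Membership.Propositional.Properties using (∈-filter⁺; ∈-filter⁻)
open import Data.List.Properties using (filter-all; filter-none)
open import Data.List.Relation.Unary.All as All using (All; []; _∷_)
open import Data.List.Relation.Unary.AllPairs using (AllPairs; []; _∷_)
open import Data.List.Relation.Unary.Any as Any using (Any; here; there; any?)
open import Data.List.Relation.Unary.Unique.Propositional using (Unique)
import Data.List.Relation.Unary.Unique.Propositional.Properties as Unique
open import Data.Nat using (ℕ; zero; suc; _+_; _*_; _≤_; _<_; z≤n; s≤s; _≤?_)
open import Data.Nat.ListAction using (sum)
open import Data.Nat.Properties
  using (≤-refl; ≤-trans; ≤-reflexive; n≤1+n; m≤m+n; <⇒≱; ≰⇒>; m≤n⇒∃[o]m+o≡n; +-assoc; +-suc;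
         +-mono-≤; +-monoˡ-≤; +-monoʳ-≤; +-mono-≤-<; *-suc; +-commutativeSemigroup;
         module ≤-Reasoning)
open import Algebra.Properties.CommutativeSemigroup +-commutativeSemigroup using (x∙yz≈y∙xz)
open import Data.Product using (∃-syntax; _×_; _,_)
open import Data.Sum using (_⊎_; inj₁; inj₂)
open import Relation.Binary.PropositionalEquality using (_≡_; _≢_; refl; sym; trans; cong; subst; ≢-sym)
open import Relation.Nullary using (¬_; Dec; yes; no; does; contradiction)
open import Relation.Nullary.Decidable using (¬?; _×-dec_)
open import Relation.Unary using (Pred; Decidable; _∪_)
open import Relation.Unary.Properties using (_∪?_)
open import Level using (0ℓ)

module _ {A : Set} {P : Pred A 0ℓ} (P? : Decidable P) where

  length-filter-∷ : ∀ x xs → length (filter P? xs) ≤ length (filter P? (x ∷ xs))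
  length-filter-∷ x xs with does (P? x)
  ... | true  = n≤1+n _
  ... | false = ≤-refl

  length-filter≤1 : ∀ {xs} → Unique xs →
    (∀ {a b} → a ∈ₗ xs → b ∈ₗ xs → P a → P b → a ≡ b) → length (filter P? xs) ≤ 1
  length-filter≤1 {[]}     _              _        = z≤n
  length-filter≤1 {x ∷ xs} (x∉xs ∷ xs-uniq) P-unique with P? x
  ... | yes Px = s≤s (≤-reflexive (cong length (filter-none P? (All.tabulate ¬P))))
    where
      ¬P : ∀ {b} → b ∈ₗ xs → ¬ P b
      ¬P b∈xs Pb = All.lookup x∉xs b∈xs (P-unique (here refl) (there b∈xs) Px Pb)
  ... | no _ = length-filter≤1 xs-uniq (λ a∈ b∈ → P-unique (there a∈) (there b∈))

module _ {A : Set} {P Q : Pred A 0ℓ} (P? : Decidable P) (Q? : Decidable Q) where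

  length-filter-∪ : ∀ xs →
    length (filter (P? ∪? Q?) xs) ≤ length (filter P? xs) + length (filter Q? xs)
  length-filter-∪ []       = z≤n
  length-filter-∪ (x ∷ xs) with P? x | Q? x | length-filter-∪ xs
  ... | yes _ | yes _ | ih = s≤s (≤-trans ih (+-monoʳ-≤ _ (n≤1+n _)))
  ... | yes _ | no _  | ih = s≤s ih
  ... | no _  | yes _ | ih = ≤-trans (s≤s ih) (≤-reflexive (sym (+-suc _ _)))
  ... | no _  | no _  | ih = ih

  length≤filter-∪ : ∀ {xs} → All (P ∪ Q) xs →
    length xs ≤ length (filter P? xs) + length (filter Q? xs)
  length≤filter-∪ {xs} P∪Q =
    subst (_≤ length (filter P? xs) + length (filter Q? xs))
          (cong length (filter-all (P? ∪? Q?) P∪Q))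
          (length-filter-∪ xs)

Unique⇒two-distinct : ∀ {A : Set} {xs : List A} {y} → Unique xs → y ∈ₗ xs → length xs ≢ 1 →
  ∃[ x₁ ] ∃[ x₂ ] (x₁ ≢ x₂ × x₁ ∈ₗ xs × x₂ ∈ₗ xs)
Unique⇒two-distinct {xs = _ ∷ []}    _                   _ ≢1 = contradiction refl ≢1
Unique⇒two-distinct {xs = _ ∷ _ ∷ _} ((x₁≢x₂ ∷ _) ∷ _) _ _  =
  _ , _ , x₁≢x₂ , here refl , there (here refl)

pairs : ℕ → ℕ
pairs zero    = 0
pairs (suc n) = n + pairs n

module Digraph {A : Set} {R : A → A → Set} (R? : ∀ x y → Dec (R x y)) where

  outdegree : List A → A → ℕ
  outdegree ys x = length (filter (R? x) ys)

  indegree : List A → A → ℕ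
  indegree ys y = length (filter (λ x → R? x y) ys)

  arcs : List A → List A → ℕ
  arcs xs ys = sum (map (outdegree ys) xs)

  arcs-∷ʳ : ∀ xs y ys → arcs xs (y ∷ ys) ≡ indegree xs y + arcs xs ys
  arcs-∷ʳ []       y ys = refl
  arcs-∷ʳ (x ∷ xs) y ys with does (R? x y)
  ... | true  = cong suc (trans (cong (outdegree ys x +_) (arcs-∷ʳ xs y ys))
                               (x∙yz≈y∙xz (outdegree ys x) (indegree xs y) (arcs xs ys)))
  ... | false = trans (cong (outdegree ys x +_) (arcs-∷ʳ xs y ys))
                      (x∙yz≈y∙xz (outdegree ys x) (indegree xs y) (arcs xs ys))

  pairs≤arcs : ∀ {xs} → AllPairs (λ x y → R x y ⊎ R y x) xs → pairs (length xs) ≤ arcs xs xs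
  pairs≤arcs {[]}     []             = z≤n
  pairs≤arcs {x ∷ xs} (x~xs ∷ xs-tot) = begin
    length xs + pairs (length xs)
      ≤⟨ +-mono-≤ (length≤filter-∪ (R? x) (λ y → R? y x) x~xs) (pairs≤arcs xs-tot) ⟩
    (outdegree xs x + indegree xs x) + arcs xs xs
      ≡⟨ +-assoc (outdegree xs x) _ _ ⟩
    outdegree xs x + (indegree xs x + arcs xs xs)
      ≡⟨ cong (outdegree xs x +_) (sym (arcs-∷ʳ xs x xs)) ⟩
    outdegree xs x + arcs xs (x ∷ xs)
      ≤⟨ +-monoˡ-≤ _ (length-filter-∷ (R? x) x xs) ⟩
    outdegree (x ∷ xs) x + arcs xs (x ∷ xs) ∎
    where open ≤-Reasoning

  arcs≤d*length : ∀ {d} xs {ys} → All (λ x → outdegree ys x ≤ d) xs → arcs xs ys ≤ d * length xs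
  arcs≤d*length {d} []       []           = z≤n
  arcs≤d*length {d} (x ∷ xs) {ys} (x≤d ∷ xs≤d) =
    ≤-trans (+-mono-≤ x≤d (arcs≤d*length xs {ys} xs≤d)) (≤-reflexive (sym (*-suc d (length xs))))

  pairs≤outdegree*length : ∀ {d xs} → AllPairs (λ x y → R x y ⊎ R y x) xs →
    All (λ x → outdegree xs x ≤ d) xs → pairs (length xs) ≤ d * length xs
  pairs≤outdegree*length {xs = xs} tot deg = ≤-trans (pairs≤arcs tot) (arcs≤d*length xs {xs} deg)

2*[6+m]<pairs[6+m] : ∀ m → 2 * (6 + m) < pairs (6 + m)
2*[6+m]<pairs[6+m] zero    = m≤m+n 13 2
2*[6+m]<pairs[6+m] (suc m) = begin-strict
  2 * (7 + m)            ≡⟨ *-suc 2 (6 + m) ⟩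
  2 + 2 * (6 + m)        <⟨ +-mono-≤-< (m≤m+n 2 (4 + m)) (2*[6+m]<pairs[6+m] m) ⟩
  (6 + m) + pairs (6 + m) ∎
  where open ≤-Reasoning

pairs≤2*n⇒n≤5 : ∀ n → pairs n ≤ 2 * n → n ≤ 5
pairs≤2*n⇒n≤5 n pairs≤2n with n ≤? 5
... | yes n≤5 = n≤5
... | no n≰5 with m , refl ← m≤n⇒∃[o]m+o≡n (≰⇒> n≰5) =
  contradiction pairs≤2n (<⇒≱ (2*[6+m]<pairs[6+m] m))

unique-length≤∣p∣ : ∀ {n} (p : Subset n) {xs} → Unique xs → All (_∈ p) xs → length xs ≤ ∣ p ∣
unique-length≤∣p∣ p {[]}     _              _             = z≤n
unique-length≤∣p∣ p {x ∷ xs} (x∉xs ∷ xs-uniq) (x∈p ∷ xs⊆p) =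
  ≤-trans (s≤s (unique-length≤∣p∣ (p - x) xs-uniq xs⊆p-x)) (x∈p⇒∣p-x∣<∣p∣ x∈p)
  where
    xs⊆p-x : All (_∈ p - x) xs
    xs⊆p-x = All.zipWith (λ (y∈p , x≢y) → x∈p∧x≢y⇒x∈p-y y∈p (≢-sym x≢y)) (xs⊆p , x∉xs)

module _ {n} {p : Subset n} (∣p∣≡3 : ∣ p ∣ ≡ 3) {a b c : Fin n}
         (a≢b : a ≢ b) (a≢c : a ≢ c) (b≢c : b ≢ c) (a∈p : a ∈ p) (b∈p : b ∈ p) (c∈p : c ∈ p) where

  fourth∉triple : ∀ {d} → a ≢ d → b ≢ d → c ≢ d → d ∉ p
  fourth∉triple a≢d b≢d c≢d d∈p = <⇒≱ (s≤s (s≤s (s≤s (s≤s z≤n))))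
    (subst (4 ≤_) ∣p∣≡3 (unique-length≤∣p∣ p
      ((a≢b ∷ a≢c ∷ a≢d ∷ []) ∷ (b≢c ∷ b≢d ∷ []) ∷ (c≢d ∷ []) ∷ [] ∷ [])
      (a∈p ∷ b∈p ∷ c∈p ∷ d∈p ∷ [])))

  triple⊆ : ∀ {q} → a ∈ q → b ∈ q → c ∈ q → p ⊆ q
  triple⊆ {q} a∈q b∈q c∈q {d} d∈p with d ∈? q
  ... | yes d∈q = d∈q
  ... | no  d∉q = contradiction d∈p (fourth∉triple (∈q⇒≢d a∈q) (∈q⇒≢d b∈q) (∈q⇒≢d c∈q))
    where
      ∈q⇒≢d : ∀ {e} → e ∈ q → e ≢ d
      ∈q⇒≢d e∈q refl = d∉q e∈q

triple-≡ : ∀ {n} {p q : Subset n} {a b c} → ∣ p ∣ ≡ 3 → ∣ q ∣ ≡ 3 → a ≢ b → a ≢ c → b ≢ c →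
  a ∈ p → b ∈ p → c ∈ p → a ∈ q → b ∈ q → c ∈ q → p ≡ q
triple-≡ ∣p∣≡3 ∣q∣≡3 a≢b a≢c b≢c a∈p b∈p c∈p a∈q b∈q c∈q =
  ⊆-antisym (triple⊆ ∣p∣≡3 a≢b a≢c b≢c a∈p b∈p c∈p a∈q b∈q c∈q)
            (triple⊆ ∣q∣≡3 a≢b a≢c b≢c a∈q b∈q c∈q a∈p b∈p c∈p)

∈∧∉⇒≢ : ∀ {n} {p q : Subset n} {a} → a ∈ p → a ∉ q → p ≢ q
∈∧∉⇒≢ a∈p a∉q refl = a∉q a∈p

HasTraceEdge : ∀ {n} → Hypergraph n → Fin n → Fin n → Fin n → Fin n → Set
HasTraceEdge H a b c d = Any (λ f → TraceEdge f a b c d) H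

hasTraceEdge? : ∀ {n} (H : Hypergraph n) a b c d → Dec (HasTraceEdge H a b c d)
hasTraceEdge? H a b c d = any? (λ f → a ∈? f ×-dec b ∈? f ×-dec ¬? (c ∈? f) ×-dec ¬? (d ∈? f)) H

HasTraceEdge-swap : ∀ {n} {H : Hypergraph n} {a b c d} → HasTraceEdge H a b c d → HasTraceEdge H b a d c
HasTraceEdge-swap = Any.map (λ (a∈f , b∈f , c∉f , d∉f) → b∈f , a∈f , d∉f , c∉f)

-- The four edges are automatically distinct: f_i contains a vertex that f_j misses.
C4-trace : ∀ {n} {H : Hypergraph n} {a₁ a₂ a₃ a₄} →
  a₁ ≢ a₂ → a₁ ≢ a₃ → a₁ ≢ a₄ → a₂ ≢ a₃ → a₂ ≢ a₄ → a₃ ≢ a₄ →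
  HasTraceEdge H a₁ a₂ a₃ a₄ → HasTraceEdge H a₂ a₃ a₄ a₁ →
  HasTraceEdge H a₃ a₄ a₁ a₂ → HasTraceEdge H a₄ a₁ a₂ a₃ → ContainsC4Trace H
C4-trace {a₁ = a₁} {a₂} {a₃} {a₄} a₁≢a₂ a₁≢a₃ a₁≢a₄ a₂≢a₃ a₂≢a₄ a₃≢a₄ t₁ t₂ t₃ t₄
  with find t₁ | find t₂ | find t₃ | find t₄
... | f₁ , f₁∈H , tr₁@(a₁∈f₁ , a₂∈f₁ , _ , _)
    | f₂ , f₂∈H , tr₂@(a₂∈f₂ , a₃∈f₂ , _ , a₁∉f₂)
    | f₃ , f₃∈H , tr₃@(a₃∈f₃ , _ , a₁∉f₃ , a₂∉f₃)
    | f₄ , f₄∈H , tr₄@(_ , _ , a₂∉f₄ , a₃∉f₄) =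
  a₁ , a₂ , a₃ , a₄ , f₁ , f₂ , f₃ , f₄ ,
  a₁≢a₂ , a₁≢a₃ , a₁≢a₄ , a₂≢a₃ , a₂≢a₄ , a₃≢a₄ ,
  ∈∧∉⇒≢ a₁∈f₁ a₁∉f₂ , ∈∧∉⇒≢ a₁∈f₁ a₁∉f₃ , ∈∧∉⇒≢ a₂∈f₁ a₂∉f₄ ,
  ∈∧∉⇒≢ a₂∈f₂ a₂∉f₃ , ∈∧∉⇒≢ a₃∈f₂ a₃∉f₄ , ∈∧∉⇒≢ a₃∈f₃ a₃∉f₄ ,
  f₁∈H , f₂∈H , f₃∈H , f₄∈H , tr₁ , tr₂ , tr₃ , tr₄

-- Every edge through u and w meets {v, a}.
Blocked : ∀ {n} → Hypergraph n → Fin n → Fin n → Fin n → Fin n → Set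
Blocked H u v w a = w ≢ a × ¬ HasTraceEdge H u w v a

blocked? : ∀ {n} (H : Hypergraph n) u v w a → Dec (Blocked H u v w a)
blocked? H u v w a = ¬? (w ≟ a) ×-dec ¬? (hasTraceEdge? H u w v a)

module _ {n} {H : Hypergraph n} (H-uniform : ThreeUniform H) where
  open ThreeUniform H-uniform

  edge-size : ∀ {e} → e ∈ₗ H → ∣ e ∣ ≡ 3
  edge-size = All.lookup edges-size3

  through? : (x z : Fin n) → Decidable (λ e → x ∈ e × z ∈ e)
  through? x z e = (x ∈? e) ×-dec (z ∈? e)

  -- The edge of B through x and z is not the only edge through them: otherwise codeg x z ≡ 1.
  N1⇒two-edges : ∀ {x z} → N1 H x z →
    ∃[ e₁ ] ∃[ e₂ ] (e₁ ≢ e₂ × e₁ ∈ₗ H × e₂ ∈ₗ H × x ∈ e₁ × z ∈ e₁ × x ∈ e₂ × z ∈ e₂)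
  N1⇒two-edges {x} {z} (z≢x , e , (e∈H , e∉A) , x∈e , z∈e) =
    let e₁ , e₂ , e₁≢e₂ , e₁∈ , e₂∈ =
          Unique⇒two-distinct (Unique.filter⁺ (through? x z) edges-distinct)
                              (∈-filter⁺ (through? x z) e∈H (x∈e , z∈e))
                              (λ codeg≡1 → e∉A (e∈H , x , z , ≢-sym z≢x , x∈e , z∈e , codeg≡1))
        e₁∈H , x∈e₁ , z∈e₁ = ∈-filter⁻ (through? x z) e₁∈
        e₂∈H , x∈e₂ , z∈e₂ = ∈-filter⁻ (through? x z) e₂∈
    in e₁ , e₂ , e₁≢e₂ , e₁∈H , e₂∈H , x∈e₁ , z∈e₁ , x∈e₂ , z∈e₂

  -- A 3-edge through x and w that missed y would have to contain both a and b.
  doubly-blocked⇒∈ : ∀ {x y w a b} → x ≢ w → a ≢ x → b ≢ x → a ≢ b →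
    Blocked H x y w a → Blocked H x y w b → ∀ {e} → e ∈ₗ H → x ∈ e → w ∈ e → y ∈ e
  doubly-blocked⇒∈ {x} {y} {w} {a} {b} x≢w a≢x b≢x a≢b (w≢a , ¬xwya) (w≢b , ¬xwyb) {e} e∈H x∈e w∈e
    with y ∈? e | a ∈? e | b ∈? e
  ... | yes y∈e | _       | _       = y∈e
  ... | no  y∉e | no  a∉e | _       = contradiction (lose e∈H (x∈e , w∈e , y∉e , a∉e)) ¬xwya
  ... | no  y∉e | yes _   | no  b∉e = contradiction (lose e∈H (x∈e , w∈e , y∉e , b∉e)) ¬xwyb
  ... | no  _   | yes a∈e | yes b∈e = contradiction b∈e
    (fourth∉triple (edge-size e∈H) x≢w (≢-sym a≢x) w≢a x∈e w∈e a∈e (≢-sym b≢x) w≢b a≢b)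

  Blocked-unique : ∀ {x y w a b} → y ≢ x → y ≢ w → N1 H x w → a ≢ x → b ≢ x →
    Blocked H x y w a → Blocked H x y w b → a ≡ b
  Blocked-unique {a = a} {b} y≢x y≢w x~w@(w≢x , _) a≢x b≢x blocked-a blocked-b with a ≟ b
  ... | yes a≡b = a≡b
  ... | no  a≢b =
    let e₁ , e₂ , e₁≢e₂ , e₁∈H , e₂∈H , x∈e₁ , w∈e₁ , x∈e₂ , w∈e₂ = N1⇒two-edges x~w
        y∈ = doubly-blocked⇒∈ (≢-sym w≢x) a≢x b≢x a≢b blocked-a blocked-b
    in contradiction (triple-≡ (edge-size e₁∈H) (edge-size e₂∈H) (≢-sym w≢x) (≢-sym y≢x) (≢-sym y≢w)
                               x∈e₁ w∈e₁ (y∈ e₁∈H x∈e₁ w∈e₁) x∈e₂ w∈e₂ (y∈ e₂∈H x∈e₂ w∈e₂))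
                     e₁≢e₂

module CommonNeighbours {n} {H : Hypergraph n} (H-uniform : ThreeUniform H)
                        (no-C4 : ¬ ContainsC4Trace H) {x y : Fin n} (x≢y : x ≢ y) where

  CommonNeighbour : Fin n → Set
  CommonNeighbour z = N1 H x z × N1 H y z

  Conflict : Fin n → Fin n → Set
  Conflict w a = Blocked H x y w a ⊎ Blocked H y x w a

  conflict? : ∀ w a → Dec (Conflict w a)
  conflict? w = blocked? H x y w ∪? blocked? H y x w

  open Digraph conflict? public

  conflict-total : ∀ {a w} → CommonNeighbour a → CommonNeighbour w → a ≢ w →
    Conflict a w ⊎ Conflict w a
  conflict-total {a} {w} ((a≢x , _) , (a≢y , _)) ((w≢x , _) , (w≢y , _)) a≢w
    with hasTraceEdge? H x a y w | hasTraceEdge? H y a x w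
       | hasTraceEdge? H x w y a | hasTraceEdge? H y w x a
  ... | no ¬t | _     | _     | _     = inj₁ (inj₁ (a≢w , ¬t))
  ... | yes _ | no ¬t | _     | _     = inj₁ (inj₂ (a≢w , ¬t))
  ... | yes _ | yes _ | no ¬t | _     = inj₂ (inj₁ (≢-sym a≢w , ¬t))
  ... | yes _ | yes _ | yes _ | no ¬t = inj₂ (inj₂ (≢-sym a≢w , ¬t))
  ... | yes xayw | yes yaxw | yes xwya | yes ywxa = contradiction
    (C4-trace (≢-sym a≢x) x≢y (≢-sym w≢x) a≢y a≢w (≢-sym w≢y)
              xayw (HasTraceEdge-swap yaxw) ywxa (HasTraceEdge-swap xwya))
    no-C4

  conflicts-semicomplete : ∀ {zs} → Unique zs → All CommonNeighbour zs →
    AllPairs (λ a w → Conflict a w ⊎ Conflict w a) zs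
  conflicts-semicomplete []                [] = []
  conflicts-semicomplete (a∉zs ∷ zs-uniq) (a~ ∷ zs~) =
    All.zipWith (λ (w~ , a≢w) → conflict-total a~ w~ a≢w) (zs~ , a∉zs)
      ∷ conflicts-semicomplete zs-uniq zs~

  conflict-outdegree≤2 : ∀ {zs w} → Unique zs → All CommonNeighbour zs → CommonNeighbour w →
    outdegree zs w ≤ 2
  conflict-outdegree≤2 {zs} {w} zs-uniq zs~ (x~w@(w≢x , _) , y~w@(w≢y , _)) =
    ≤-trans (length-filter-∪ (blocked? H x y w) (blocked? H y x w) zs)
            (+-mono-≤ (length-filter≤1 (blocked? H x y w) zs-uniq λ a∈ b∈ →
                         Blocked-unique H-uniform (≢-sym x≢y) (≢-sym w≢y) x~w (≢x a∈) (≢x b∈))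
                      (length-filter≤1 (blocked? H y x w) zs-uniq λ a∈ b∈ →
                         Blocked-unique H-uniform x≢y (≢-sym w≢x) y~w (≢y a∈) (≢y b∈)))
    where
      ≢x : ∀ {a} → a ∈ₗ zs → a ≢ x
      ≢x a∈ = let (a≢x , _) , _ = All.lookup zs~ a∈ in a≢x
      ≢y : ∀ {a} → a ∈ₗ zs → a ≢ y
      ≢y a∈ = let _ , (a≢y , _) = All.lookup zs~ a∈ in a≢y

lemma6p1 : {n : ℕ} (H : Hypergraph n) → ThreeUniform H → ¬ ContainsC4Trace H →
    (x y : Fin n) → x ≢ y →
    (zs : List (Fin n)) → Unique zs → All (λ z → N1 H x z × N1 H y z) zs →
    length zs ≤ 7
lemma6p1 H H-uniform no-C4 x y x≢y zs zs-uniq zs~ = ≤-trans (pairs≤2*n⇒n≤5 (length zs) pairs≤2k) (m≤m+n 5 2)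
  where
    open CommonNeighbours H-uniform no-C4 x≢y
    pairs≤2k : pairs (length zs) ≤ 2 * length zs
    pairs≤2k = pairs≤outdegree*length (conflicts-semicomplete zs-uniq zs~)
                                      (All.map (conflict-outdegree≤2 zs-uniq zs~) zs~)
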